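{- Let $r\ge 1$ be an integer, let $A$ be the set of even non-negative integers and $B$ the set of odd non-negative integers. Then for every integer $n\ge r$, \[ g^{(r)}_A(n)=g^{(r)}_B(n)=2^{\lfloor \frac{r-1}{r}n\rfloor}. \]
   Context: An $r$-uniform hypergraph is a finite vertex set with a family of $r$-element subsets (hyperedges). A vertex is isolated if it lies in no hyperedge. Given a non-empty set $A$ of non-negative integers, a set $S$ of vertices is an $A$-transversal of an $r$-uniform hypergraph $\mathcal{H}$ if $|H\cap S|\in A$ for every hyperedge $H$. For $n\ge r$, $g^{(r)}_A(n)$ denotes the maximum number of $A$-transversals in an $r$-uniform hypergraph on $n$ vertices with no isolated vertices. -}

module Defs where

open import Data.Nat using (ℕ; zero; suc; _≤_)
open import Data.Nat.Divisibility using (_∣_; _∣?_)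
open import Data.Fin using (Fin)
open import Data.Fin.Subset using (Subset; _∈_; _∩_; ∣_∣; inside; outside)
open import Data.Vec using (_∷_; [])
open import Data.List using (List; []; _∷_; _++_; map; filter; length)
open import Data.List.Relation.Unary.All using (All; all?)
open import Data.List.Relation.Unary.Any using (Any)
open import Data.Product using (Σ; _×_)
open import Relation.Binary.PropositionalEquality using (_≡_)
open import Relation.Nullary using (¬_; ¬?)
open import Relation.Unary using (Pred; Decidable)
open import Level using (0ℓ)

record Hypergraph (r n : ℕ) : Set where
  field
    edges   : List (Subset n)
    uniform : All (λ H → ∣ H ∣ ≡ r) edges
open Hypergraph public

Isolated : ∀ {r n} → Hypergraph r n → Fin n → Set
Isolated 𝓗 v = ¬ Any (λ H → v ∈ H) (edges 𝓗)

NoIsolated : ∀ {r n} → Hypergraph r n → Set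
NoIsolated {n = n} 𝓗 = (v : Fin n) → ¬ Isolated 𝓗 v

IsTransversal : ∀ {r n} → Pred ℕ 0ℓ → Hypergraph r n → Subset n → Set
IsTransversal A 𝓗 S = All (λ H → A ∣ H ∩ S ∣) (edges 𝓗)

allSubsets : (n : ℕ) → List (Subset n)
allSubsets zero = [] ∷ []
allSubsets (suc n) = map (inside ∷_) (allSubsets n) ++ map (outside ∷_) (allSubsets n)

numTransversals : ∀ {r n} (A : Pred ℕ 0ℓ) → Decidable A → Hypergraph r n → ℕ
numTransversals {n = n} A A? 𝓗 =
  length (filter (λ S → all? (λ H → A? ∣ H ∩ S ∣) (edges 𝓗)) (allSubsets n))

IsG : (A : Pred ℕ 0ℓ) → Decidable A → (r n m : ℕ) → Set
IsG A A? r n m =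
  ((𝓗 : Hypergraph r n) → NoIsolated 𝓗 → numTransversals A A? 𝓗 ≤ m)
  × Σ (Hypergraph r n) (λ 𝓗 → NoIsolated 𝓗 × numTransversals A A? 𝓗 ≡ m)

Even : Pred ℕ 0ℓ
Even k = 2 ∣ k

Even? : Decidable Even
Even? k = 2 ∣? k

Odd : Pred ℕ 0ℓ
Odd k = ¬ (2 ∣ k)

Odd? : Decidable Odd
Odd? k = ¬? (2 ∣? k)

{-# OPTIONS --safe #-}
module Submission where

-- Upper bound: run through the edges keeping a set of covered vertices and a set of pivots; an edge
-- containing an uncovered vertex v makes v a new pivot. Without isolated vertices everything ends up
-- covered, so n ≤ r k for the k pivots, and a transversal is determined by its values off the pivots,
-- each pivot being pinned down by the parity of the edge that introduced it. So there are at most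
-- 2^(n − k) ≤ 2^⌊(r − 1)n/r⌋ transversals.
-- Lower bound: cover the vertices by ⌈n/r⌉ intervals of length r, each with a pivot (its last vertex)
-- lying in no interval further left. Correcting any set at the pivots from left to right yields a
-- transversal, so there are at least 2^(n − ⌈n/r⌉) = 2^⌊(r − 1)n/r⌋ of them.

open import Defs

open import Data.Bool using (Bool; true; false; not; _∧_; _xor_)
open import Data.Bool.Properties using (xor-assoc; xor-comm; xor-same; xor-annihilates-not; not-involutive)
open import Data.Fin using (Fin; zero; suc; toℕ; fromℕ; fromℕ<)
open import Data.Fin.Properties using (any?; toℕ-fromℕ; toℕ-fromℕ<; toℕ<n)
open import Data.Fin.Subset using (Subset; inside; outside; _∈_; _∉_; _⊆_; _∩_; _∪_; ∣_∣; ⊥; ⊤)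
open import Data.Fin.Subset.Properties
  using (_∈?_; drop-there; drop-not-there; drop-∷-⊆; ∉⊥; ⊆-refl; ⊆-trans; p⊆p∪q; q⊆p∪q; p⊆q⇒∣p∣≤∣q∣; ∣p∣≤∣x∷p∣;
         ∣⊥∣≡0; ∣⊤∣≡n)
open import Data.List using (List; []; _∷_; _++_; map; filter; length)
open import Data.List.Properties using (length-++; filter-++)
open import Data.List.Relation.Unary.All using (All; []; _∷_; all?)
import Data.List.Relation.Unary.All as All
open import Data.List.Relation.Unary.Any using (Any; here; there)
open import Data.Nat using (ℕ; zero; suc; _+_; _*_; _∸_; _^_; _≤_; _<_; z≤n; s≤s; z<s; s≤s⁻¹; _<?_; NonZero)
open import Data.Nat.DivMod using (_/_; _%_; m<n*o⇒m/o<n; m≡m%n+[m/n]*n; m%n<n; m/n*n≤m; m*n/n≡m; /-monoˡ-≤)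
open import Data.Nat.Divisibility using (_∣_; divides; ∣-refl; ∣m∣n⇒∣m+n; _∣0)
open import Data.Nat.Properties
open import Data.Nat.Tactic.RingSolver using (solve-∀)
open import Data.Product using (Σ; ∃; _×_; _,_; proj₁; proj₂)
open import Data.Sum using (_⊎_; inj₁; inj₂)
open import Data.Unit using (tt) renaming (⊤ to Unit)
open import Data.Vec using (_∷_; []; lookup; _[_]≔_; here; there)
open import Data.Vec.Properties using (∷-injectiveʳ; []≔-lookup)
open import Function using (_∘_)
open import Level using (0ℓ)
open import Relation.Binary.PropositionalEquality
open import Relation.Nullary using (¬_; yes; no; does; contradiction)
open import Relation.Nullary.Decidable using (_×-dec_; _⊎-dec_; ¬?; decidable-stable)
open import Relation.Unary using (Pred; Decidable)

parity : ℕ → Bool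
parity zero    = false
parity (suc k) = not (parity k)

2∣⇒parity≡false : ∀ {k} → 2 ∣ k → parity k ≡ false
2∣⇒parity≡false (divides q refl) = parity[q*2] q
  where
  parity[q*2] : ∀ q → parity (q * 2) ≡ false
  parity[q*2] zero    = refl
  parity[q*2] (suc q) = trans (not-involutive _) (parity[q*2] q)

parity≡false⇒2∣ : ∀ {k} → parity k ≡ false → 2 ∣ k
parity≡false⇒2∣ {zero}        _ = 2 ∣0
parity≡false⇒2∣ {suc zero}    ()
parity≡false⇒2∣ {suc (suc k)} p = ∣m∣n⇒∣m+n ∣-refl (parity≡false⇒2∣ (trans (sym (not-involutive _)) p))

2∤⇒parity≡true : ∀ {k} → ¬ 2 ∣ k → parity k ≡ true
2∤⇒parity≡true {k} 2∤k with parity k in p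
... | true  = refl
... | false = contradiction (parity≡false⇒2∣ p) 2∤k

parity≡true⇒2∤ : ∀ {k} → parity k ≡ true → ¬ 2 ∣ k
parity≡true⇒2∤ p 2∣k with trans (sym p) (2∣⇒parity≡false 2∣k)
... | ()

x⊕x⊕y≡y : ∀ x y → x xor x xor y ≡ y
x⊕x⊕y≡y x y = trans (sym (xor-assoc x x y)) (cong (_xor y) (xor-same x))

x⊕a⊕b≡x⇒a≡b : ∀ x a b → x xor a xor b ≡ x → a ≡ b
x⊕a⊕b≡x⇒a≡b _     true  true  _ = refl
x⊕a⊕b≡x⇒a≡b _     false false _ = refl
x⊕a⊕b≡x⇒a≡b true  true  false ()
x⊕a⊕b≡x⇒a≡b false true  false ()
x⊕a⊕b≡x⇒a≡b true  false true  ()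
x⊕a⊕b≡x⇒a≡b false false true  ()

parity-∷ : ∀ {n} b (p : Subset n) → parity ∣ b ∷ p ∣ ≡ b xor parity ∣ p ∣
parity-∷ true  p = refl
parity-∷ false p = refl

∩-[]≔-∉ : ∀ {n} {H : Subset n} {v} (T : Subset n) b → v ∉ H → H ∩ (T [ v ]≔ b) ≡ H ∩ T
∩-[]≔-∉ {H = outside ∷ H} {zero}  (t ∷ T) b v∉H = refl
∩-[]≔-∉ {H = inside  ∷ H} {zero}  (t ∷ T) b v∉H = contradiction here v∉H
∩-[]≔-∉ {H = h ∷ H}       {suc v} (t ∷ T) b v∉H = cong (h ∧ t ∷_) (∩-[]≔-∉ T b (drop-not-there v∉H))

parity∣∩[]≔∣ : ∀ {n} {H : Subset n} {v} (T : Subset n) b → v ∈ H →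
  parity ∣ H ∩ (T [ v ]≔ b) ∣ ≡ parity ∣ H ∩ T ∣ xor lookup T v xor b
parity∣∩[]≔∣ {H = inside ∷ H} (false ∷ T) b here =
  trans (parity-∷ b (H ∩ T)) (xor-comm b (parity ∣ H ∩ T ∣))
parity∣∩[]≔∣ {H = inside ∷ H} (true ∷ T) b here =
  trans (parity-∷ b (H ∩ T)) (trans (xor-comm b P) (sym (xor-annihilates-not P b)))
  where P = parity ∣ H ∩ T ∣
parity∣∩[]≔∣ {H = h ∷ H} {suc v} (t ∷ T) b (there v∈H) = begin
  parity ∣ h ∧ t ∷ H ∩ (T [ v ]≔ b) ∣               ≡⟨ parity-∷ (h ∧ t) (H ∩ (T [ v ]≔ b)) ⟩
  (h ∧ t) xor parity ∣ H ∩ (T [ v ]≔ b) ∣           ≡⟨ cong ((h ∧ t) xor_) (parity∣∩[]≔∣ T b v∈H) ⟩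
  (h ∧ t) xor parity ∣ H ∩ T ∣ xor lookup T v xor b  ≡⟨ xor-assoc (h ∧ t) _ _ ⟨
  ((h ∧ t) xor parity ∣ H ∩ T ∣) xor lookup T v xor b
    ≡⟨ cong (_xor lookup T v xor b) (parity-∷ (h ∧ t) (H ∩ T)) ⟨
  parity ∣ h ∧ t ∷ H ∩ T ∣ xor lookup T v xor b       ∎
  where open ≡-Reasoning

∣p∪q∣≤∣p∣+∣q∣ : ∀ {n} (p q : Subset n) → ∣ p ∪ q ∣ ≤ ∣ p ∣ + ∣ q ∣
∣p∪q∣≤∣p∣+∣q∣ []            []            = z≤n
∣p∪q∣≤∣p∣+∣q∣ (inside ∷ p)  (s ∷ q)       =
  s≤s (≤-trans (∣p∪q∣≤∣p∣+∣q∣ p q) (+-monoʳ-≤ ∣ p ∣ (∣p∣≤∣x∷p∣ s q)))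
∣p∪q∣≤∣p∣+∣q∣ (outside ∷ p) (inside ∷ q)  =
  ≤-trans (s≤s (∣p∪q∣≤∣p∣+∣q∣ p q)) (≤-reflexive (sym (+-suc ∣ p ∣ ∣ q ∣)))
∣p∪q∣≤∣p∣+∣q∣ (outside ∷ p) (outside ∷ q) = ∣p∪q∣≤∣p∣+∣q∣ p q

∣p[x]≔inside∣≡1+∣p∣ : ∀ {n} {p : Subset n} {x} → x ∉ p → ∣ p [ x ]≔ inside ∣ ≡ suc ∣ p ∣
∣p[x]≔inside∣≡1+∣p∣ {p = outside ∷ p} {zero}  x∉p = refl
∣p[x]≔inside∣≡1+∣p∣ {p = inside  ∷ p} {zero}  x∉p = contradiction here x∉p
∣p[x]≔inside∣≡1+∣p∣ {p = outside ∷ p} {suc x} x∉p = ∣p[x]≔inside∣≡1+∣p∣ (drop-not-there x∉p)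
∣p[x]≔inside∣≡1+∣p∣ {p = inside  ∷ p} {suc x} x∉p =
  cong suc (∣p[x]≔inside∣≡1+∣p∣ (drop-not-there x∉p))

∣p[x]≔inside∣≤1+∣p∣ : ∀ {n} (p : Subset n) x → ∣ p [ x ]≔ inside ∣ ≤ suc ∣ p ∣
∣p[x]≔inside∣≤1+∣p∣ (outside ∷ p) zero    = ≤-refl
∣p[x]≔inside∣≤1+∣p∣ (inside  ∷ p) zero    = n≤1+n _
∣p[x]≔inside∣≤1+∣p∣ (outside ∷ p) (suc x) = ∣p[x]≔inside∣≤1+∣p∣ p x
∣p[x]≔inside∣≤1+∣p∣ (inside  ∷ p) (suc x) = s≤s (∣p[x]≔inside∣≤1+∣p∣ p x)

⊆⊎∃∉ : ∀ {n} (p q : Subset n) → p ⊆ q ⊎ ∃ λ x → x ∈ p × x ∉ q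
⊆⊎∃∉ p q with any? (λ x → x ∈? p ×-dec ¬? (x ∈? q))
... | yes witness = inj₂ witness
... | no  ∄       = inj₁ λ {x} x∈p → decidable-stable (x ∈? q) (λ x∉q → ∄ (x , x∈p , x∉q))

[]≔inside-⊆ : ∀ {n} {p q : Subset n} {y} → p ⊆ q → y ∈ q → p [ y ]≔ inside ⊆ q
[]≔inside-⊆ {p = _ ∷ _}             {y = zero}  p⊆q y∈q here        = y∈q
[]≔inside-⊆ {p = _ ∷ _}             {y = zero}  p⊆q y∈q (there x∈p) = p⊆q (there x∈p)
[]≔inside-⊆ {p = _ ∷ _}             {y = suc y} p⊆q y∈q here        = p⊆q here
[]≔inside-⊆ {p = _ ∷ _} {q = _ ∷ _} {y = suc y} p⊆q y∈q (there x∈p) =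
  there ([]≔inside-⊆ (drop-∷-⊆ p⊆q) (drop-there y∈q) x∈p)

AgreeOutside : ∀ {n} → Subset n → Subset n → Subset n → Set
AgreeOutside []            []      []      = Unit
AgreeOutside (inside  ∷ D) (_ ∷ S) (_ ∷ T) = AgreeOutside D S T
AgreeOutside (outside ∷ D) (s ∷ S) (t ∷ T) = s ≡ t × AgreeOutside D S T

AgreeOutside-∷ : ∀ {n} d s {D S T : Subset n} → AgreeOutside D S T → AgreeOutside (d ∷ D) (s ∷ S) (s ∷ T)
AgreeOutside-∷ inside  s a = a
AgreeOutside-∷ outside s a = refl , a

AgreeOutside-refl : ∀ {n} (D S : Subset n) → AgreeOutside D S S
AgreeOutside-refl []      []      = tt
AgreeOutside-refl (d ∷ D) (s ∷ S) = AgreeOutside-∷ d s (AgreeOutside-refl D S)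

AgreeOutside-⊥ : ∀ {n} (S T : Subset n) → AgreeOutside ⊥ S T → S ≡ T
AgreeOutside-⊥ []      []      tt         = refl
AgreeOutside-⊥ (s ∷ S) (t ∷ T) (s≡t , a) = cong₂ _∷_ s≡t (AgreeOutside-⊥ S T a)

AgreeOutside-[]≔ : ∀ {n} (D S T : Subset n) v b →
  AgreeOutside D S T → AgreeOutside (D [ v ]≔ inside) S (T [ v ]≔ b)
AgreeOutside-[]≔ (inside  ∷ D) (s ∷ S) (t ∷ T) zero    b a       = a
AgreeOutside-[]≔ (outside ∷ D) (s ∷ S) (t ∷ T) zero    b (_ , a) = a
AgreeOutside-[]≔ (inside  ∷ D) (s ∷ S) (t ∷ T) (suc v) b = AgreeOutside-[]≔ D S T v b
AgreeOutside-[]≔ (outside ∷ D) (s ∷ S) (t ∷ T) (suc v) b (s≡t , a) = s≡t , AgreeOutside-[]≔ D S T v b a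

AgreeOutside-[]≔⁻ : ∀ {n} (D S T : Subset n) v →
  AgreeOutside (D [ v ]≔ inside) S T → AgreeOutside D S (T [ v ]≔ lookup S v)
AgreeOutside-[]≔⁻ (d       ∷ D) (s ∷ S) (t ∷ T) zero    a         = AgreeOutside-∷ d s a
AgreeOutside-[]≔⁻ (inside  ∷ D) (s ∷ S) (t ∷ T) (suc v) a         = AgreeOutside-[]≔⁻ D S T v a
AgreeOutside-[]≔⁻ (outside ∷ D) (s ∷ S) (t ∷ T) (suc v) (s≡t , a) = s≡t , AgreeOutside-[]≔⁻ D S T v a

module _ {a} {A : Set a} {P Q : Pred A 0ℓ} (P? : Decidable P) (Q? : Decidable Q) where

  private
    P∪Q? : Decidable (λ x → P x ⊎ Q x)
    P∪Q? x = P? x ⊎-dec Q? x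

  length-filter-⊎ : ∀ xs → length (filter P∪Q? xs) ≤ length (filter P? xs) + length (filter Q? xs)
  length-filter-⊎ [] = z≤n
  length-filter-⊎ (x ∷ xs) with P? x | Q? x
  ... | yes _ | yes _ = s≤s (≤-trans (length-filter-⊎ xs) (+-monoʳ-≤ (length (filter P? xs)) (n≤1+n _)))
  ... | yes _ | no  _ = s≤s (length-filter-⊎ xs)
  ... | no  _ | yes _ = ≤-trans (s≤s (length-filter-⊎ xs)) (≤-reflexive (sym (+-suc _ _)))
  ... | no  _ | no  _ = length-filter-⊎ xs

  length-filter-⊎-disjoint : (∀ x → ¬ (P x × Q x)) →
    ∀ xs → length (filter P? xs) + length (filter Q? xs) ≤ length (filter P∪Q? xs)
  length-filter-⊎-disjoint disjoint [] = z≤n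
  length-filter-⊎-disjoint disjoint (x ∷ xs) with P? x | Q? x
  ... | yes p | yes q = contradiction (p , q) (disjoint x)
  ... | yes _ | no  _ = s≤s (length-filter-⊎-disjoint disjoint xs)
  ... | no  _ | yes _ = ≤-trans (≤-reflexive (+-suc _ _)) (s≤s (length-filter-⊎-disjoint disjoint xs))
  ... | no  _ | no  _ = length-filter-⊎-disjoint disjoint xs

length-filter-map : ∀ {a b} {A : Set a} {B : Set b} {P : Pred B 0ℓ} (P? : Decidable P) (f : A → B) xs →
  length (filter P? (map f xs)) ≡ length (filter (P? ∘ f) xs)
length-filter-map P? f []       = refl
length-filter-map P? f (x ∷ xs) with does (P? (f x))
... | true  = cong suc (length-filter-map P? f xs)
... | false = length-filter-map P? f xs

count : ∀ {n} {P : Pred (Subset n) 0ℓ} → Decidable P → ℕ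
count {n} P? = length (filter P? (allSubsets n))

count-∷ : ∀ {n} {P : Pred (Subset (suc n)) 0ℓ} (P? : Decidable P) →
  count P? ≡ count (P? ∘ (inside ∷_)) + count (P? ∘ (outside ∷_))
count-∷ {n} P? = begin
  length (filter P? (map (inside ∷_) Ss ++ map (outside ∷_) Ss))
    ≡⟨ cong length (filter-++ P? (map (inside ∷_) Ss) (map (outside ∷_) Ss)) ⟩
  length (filter P? (map (inside ∷_) Ss) ++ filter P? (map (outside ∷_) Ss))
    ≡⟨ length-++ (filter P? (map (inside ∷_) Ss)) ⟩
  length (filter P? (map (inside ∷_) Ss)) + length (filter P? (map (outside ∷_) Ss))
    ≡⟨ cong₂ _+_ (length-filter-map P? (inside ∷_) Ss) (length-filter-map P? (outside ∷_) Ss) ⟩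
  count (P? ∘ (inside ∷_)) + count (P? ∘ (outside ∷_)) ∎
  where
  open ≡-Reasoning
  Ss = allSubsets n

DeterminedOutside : ∀ {n} → Subset n → Pred (Subset n) 0ℓ → Set
DeterminedOutside D P = ∀ {S T} → P S → P T → AgreeOutside D S T → S ≡ T

ReachableWithin : ∀ {n} → Subset n → Pred (Subset n) 0ℓ → Set
ReachableWithin D P = ∀ S → ∃ λ T → P T × AgreeOutside D S T

private
  2*-distrib : ∀ m n → m * (2 * n) ≡ 2 * (m * n)
  2*-distrib = solve-∀

  2*≡+ : ∀ m → 2 * m ≡ m + m
  2*≡+ m = cong (m +_) (+-identityʳ m)

  single-filter-≤ : ∀ {a} {A : Set a} {P : Pred A 0ℓ} (P? : Decidable P) x → length (filter P? (x ∷ [])) ≤ 1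
  single-filter-≤ P? x with does (P? x)
  ... | true  = ≤-refl
  ... | false = z≤n

count*2^∣D∣≤2^n : ∀ {n} (D : Subset n) {P : Pred (Subset n) 0ℓ} (P? : Decidable P) →
  DeterminedOutside D P → count P? * 2 ^ ∣ D ∣ ≤ 2 ^ n
count*2^∣D∣≤2^n [] P? _ = ≤-trans (≤-reflexive (*-identityʳ _)) (single-filter-≤ P? [])
count*2^∣D∣≤2^n {suc n} (outside ∷ D) {P} P? det = begin
  count P? * 2 ^ ∣ D ∣                           ≡⟨ cong (_* 2 ^ ∣ D ∣) (count-∷ P?) ⟩
  (count P⁺? + count P⁻?) * 2 ^ ∣ D ∣            ≡⟨ *-distribʳ-+ (2 ^ ∣ D ∣) (count P⁺?) (count P⁻?) ⟩
  count P⁺? * 2 ^ ∣ D ∣ + count P⁻? * 2 ^ ∣ D ∣  ≤⟨ +-mono-≤ (count*2^∣D∣≤2^n D P⁺? (restrict inside))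
                                                                (count*2^∣D∣≤2^n D P⁻? (restrict outside)) ⟩
  2 ^ n + 2 ^ n                                  ≡⟨ 2*≡+ (2 ^ n) ⟨
  2 ^ suc n                                      ∎
  where
  open ≤-Reasoning
  P⁺? = P? ∘ (inside ∷_)
  P⁻? = P? ∘ (outside ∷_)
  restrict : ∀ s → DeterminedOutside D (P ∘ (s ∷_))
  restrict s p q a = ∷-injectiveʳ (det p q (refl , a))
count*2^∣D∣≤2^n {suc n} (inside ∷ D) {P} P? det = begin
  count P? * 2 ^ suc ∣ D ∣              ≡⟨ cong (_* 2 ^ suc ∣ D ∣) (count-∷ P?) ⟩
  (count P⁺? + count P⁻?) * 2 ^ suc ∣ D ∣
    ≤⟨ *-monoˡ-≤ (2 ^ suc ∣ D ∣) (length-filter-⊎-disjoint P⁺? P⁻? disjoint (allSubsets n)) ⟩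
  count P±? * (2 * 2 ^ ∣ D ∣)           ≡⟨ 2*-distrib (count P±?) (2 ^ ∣ D ∣) ⟩
  2 * (count P±? * 2 ^ ∣ D ∣)           ≤⟨ *-monoʳ-≤ 2 (count*2^∣D∣≤2^n D P±? det±) ⟩
  2 * 2 ^ n                             ∎
  where
  open ≤-Reasoning
  P⁺? = P? ∘ (inside ∷_)
  P⁻? = P? ∘ (outside ∷_)
  P± : Pred (Subset n) 0ℓ
  P± S = P (inside ∷ S) ⊎ P (outside ∷ S)
  P±? : Decidable P±
  P±? S = P? (inside ∷ S) ⊎-dec P? (outside ∷ S)
  disjoint : ∀ S → ¬ (P (inside ∷ S) × P (outside ∷ S))
  disjoint S (p , q) with det p q (AgreeOutside-refl D S)
  ... | ()
  pick : ∀ {S} → P± S → Σ Bool λ s → P (s ∷ S)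
  pick (inj₁ p) = inside , p
  pick (inj₂ p) = outside , p
  det± : DeterminedOutside D P±
  det± p q a = ∷-injectiveʳ (det (proj₂ (pick p)) (proj₂ (pick q)) a)

2^n≤count*2^∣D∣ : ∀ {n} (D : Subset n) {P : Pred (Subset n) 0ℓ} (P? : Decidable P) →
  ReachableWithin D P → 2 ^ n ≤ count P? * 2 ^ ∣ D ∣
2^n≤count*2^∣D∣ [] P? reach with reach [] | P? []
... | [] , p , _ | yes _ = ≤-refl
... | [] , p , _ | no ¬p = contradiction p ¬p
2^n≤count*2^∣D∣ {suc n} (outside ∷ D) {P} P? reach = begin
  2 ^ suc n                                      ≡⟨ 2*≡+ (2 ^ n) ⟩
  2 ^ n + 2 ^ n                                  ≤⟨ +-mono-≤ (2^n≤count*2^∣D∣ D P⁺? (restrict inside))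
                                                                (2^n≤count*2^∣D∣ D P⁻? (restrict outside)) ⟩
  count P⁺? * 2 ^ ∣ D ∣ + count P⁻? * 2 ^ ∣ D ∣  ≡⟨ *-distribʳ-+ (2 ^ ∣ D ∣) (count P⁺?) (count P⁻?) ⟨
  (count P⁺? + count P⁻?) * 2 ^ ∣ D ∣            ≡⟨ cong (_* 2 ^ ∣ D ∣) (count-∷ P?) ⟨
  count P? * 2 ^ ∣ D ∣                           ∎
  where
  open ≤-Reasoning
  P⁺? = P? ∘ (inside ∷_)
  P⁻? = P? ∘ (outside ∷_)
  restrict : ∀ s → ReachableWithin D (P ∘ (s ∷_))
  restrict s S with reach (s ∷ S)
  ... | (.s ∷ T) , p , (refl , a) = T , p , a
2^n≤count*2^∣D∣ {suc n} (inside ∷ D) {P} P? reach = begin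
  2 * 2 ^ n                              ≤⟨ *-monoʳ-≤ 2 (2^n≤count*2^∣D∣ D P±? reach±) ⟩
  2 * (count P±? * 2 ^ ∣ D ∣)            ≡⟨ 2*-distrib (count P±?) (2 ^ ∣ D ∣) ⟨
  count P±? * (2 * 2 ^ ∣ D ∣)
    ≤⟨ *-monoˡ-≤ (2 ^ suc ∣ D ∣) (length-filter-⊎ P⁺? P⁻? (allSubsets n)) ⟩
  (count P⁺? + count P⁻?) * 2 ^ suc ∣ D ∣ ≡⟨ cong (_* 2 ^ suc ∣ D ∣) (count-∷ P?) ⟨
  count P? * 2 ^ suc ∣ D ∣               ∎
  where
  open ≤-Reasoning
  P⁺? = P? ∘ (inside ∷_)
  P⁻? = P? ∘ (outside ∷_)
  P±? : Decidable (λ S → P (inside ∷ S) ⊎ P (outside ∷ S))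
  P±? S = P? (inside ∷ S) ⊎-dec P? (outside ∷ S)
  reach± : ReachableWithin D (λ S → P (inside ∷ S) ⊎ P (outside ∷ S))
  reach± S with reach (inside ∷ S)
  ... | (inside  ∷ T) , p , a = T , inj₁ p , a
  ... | (outside ∷ T) , p , a = T , inj₂ p , a

ParityTransversal : ∀ {n} → Bool → List (Subset n) → Pred (Subset n) 0ℓ
ParityTransversal c L S = All (λ H → parity ∣ H ∩ S ∣ ≡ c) L

ParityTransversal-[]≔ : ∀ {n c} {L : List (Subset n)} {v T} b →
  All (v ∉_) L → ParityTransversal c L T → ParityTransversal c L (T [ v ]≔ b)
ParityTransversal-[]≔         b []           []       = []
ParityTransversal-[]≔ {T = T} b (v∉H ∷ v∉L) (p ∷ ps) =
  trans (cong (parity ∘ ∣_∣) (∩-[]≔-∉ T b v∉H)) p ∷ ParityTransversal-[]≔ b v∉L ps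

record PivotCover {n} (r : ℕ) (L : List (Subset n)) : Set where
  field
    covered pivots       : Subset n
    edges⊆covered        : All (_⊆ covered) L
    pivots⊆covered       : pivots ⊆ covered
    ∣covered∣≤r*∣pivots∣ : ∣ covered ∣ ≤ r * ∣ pivots ∣
    determined           : ∀ c → DeterminedOutside pivots (ParityTransversal c L)

PivotCover-[] : ∀ {n r} → PivotCover {n} r []
PivotCover-[] {n} {r} = record
  { covered              = ⊥
  ; pivots               = ⊥
  ; edges⊆covered        = []
  ; pivots⊆covered       = ⊆-refl
  ; ∣covered∣≤r*∣pivots∣ = subst (_≤ r * ∣ ⊥ {n} ∣) (sym (∣⊥∣≡0 n)) z≤n
  ; determined           = λ _ _ _ → AgreeOutside-⊥ _ _
  }

module _ {n r} {L : List (Subset n)} (C : PivotCover r L) (e : Subset n) where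
  open PivotCover C

  PivotCover-∷-⊆ : e ⊆ covered → PivotCover r (e ∷ L)
  PivotCover-∷-⊆ e⊆covered = record
    { covered              = covered
    ; pivots               = pivots
    ; edges⊆covered        = e⊆covered ∷ edges⊆covered
    ; pivots⊆covered       = pivots⊆covered
    ; ∣covered∣≤r*∣pivots∣ = ∣covered∣≤r*∣pivots∣
    ; determined           = λ { c (_ ∷ pS) (_ ∷ pT) → determined c pS pT }
    }

  PivotCover-∷-∉ : ∣ e ∣ ≡ r → ∀ {v} → v ∈ e → v ∉ covered → PivotCover r (e ∷ L)
  PivotCover-∷-∉ ∣e∣≡r {v} v∈e v∉covered = record
    { covered              = covered ∪ e
    ; pivots               = pivots [ v ]≔ inside
    ; edges⊆covered        = q⊆p∪q covered e ∷ edges⊆covered∪e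
    ; pivots⊆covered       = []≔inside-⊆ (⊆-trans pivots⊆covered (p⊆p∪q e)) (q⊆p∪q covered e v∈e)
    ; ∣covered∣≤r*∣pivots∣ = size
    ; determined           = determined′
    }
    where
    edges⊆covered∪e : All (_⊆ covered ∪ e) L
    edges⊆covered∪e =
      All.map {P = _⊆ covered} {Q = _⊆ covered ∪ e} (λ H⊆covered → ⊆-trans H⊆covered (p⊆p∪q e)) edges⊆covered
    v∉L : All (v ∉_) L
    v∉L = All.map (λ H⊆covered v∈H → v∉covered (H⊆covered v∈H)) edges⊆covered
    size : ∣ covered ∪ e ∣ ≤ r * ∣ pivots [ v ]≔ inside ∣
    size = begin
      ∣ covered ∪ e ∣             ≤⟨ ∣p∪q∣≤∣p∣+∣q∣ covered e ⟩
      ∣ covered ∣ + ∣ e ∣         ≤⟨ +-mono-≤ ∣covered∣≤r*∣pivots∣ (≤-reflexive ∣e∣≡r) ⟩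
      r * ∣ pivots ∣ + r          ≡⟨ +-comm (r * ∣ pivots ∣) r ⟩
      r + r * ∣ pivots ∣          ≡⟨ *-suc r ∣ pivots ∣ ⟨
      r * suc ∣ pivots ∣          ≡⟨ cong (r *_) (∣p[x]≔inside∣≡1+∣p∣ (v∉covered ∘ pivots⊆covered)) ⟨
      r * ∣ pivots [ v ]≔ inside ∣ ∎
      where open ≤-Reasoning
    -- v lies in no edge of L, so T [ v ]≔ lookup S v is a transversal of L like T, hence equal to S;
    -- the parity of e then forces lookup T v ≡ lookup S v.
    determined′ : ∀ c → DeterminedOutside (pivots [ v ]≔ inside) (ParityTransversal c (e ∷ L))
    determined′ c {S} {T} (pS₀ ∷ pS) (pT₀ ∷ pT) agree = begin
      S                           ≡⟨ S≡T′ ⟩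
      T [ v ]≔ lookup S v         ≡⟨ cong (T [ v ]≔_) Tv≡Sv ⟨
      T [ v ]≔ lookup T v         ≡⟨ []≔-lookup T v ⟩
      T                           ∎
      where
      open ≡-Reasoning
      S≡T′ : S ≡ T [ v ]≔ lookup S v
      S≡T′ = determined c pS (ParityTransversal-[]≔ (lookup S v) v∉L pT) (AgreeOutside-[]≔⁻ pivots S T v agree)
      Tv≡Sv : lookup T v ≡ lookup S v
      Tv≡Sv = x⊕a⊕b≡x⇒a≡b (parity ∣ e ∩ T ∣) (lookup T v) (lookup S v) (begin
        parity ∣ e ∩ T ∣ xor lookup T v xor lookup S v ≡⟨ parity∣∩[]≔∣ T (lookup S v) v∈e ⟨
        parity ∣ e ∩ (T [ v ]≔ lookup S v) ∣           ≡⟨ cong (λ X → parity ∣ e ∩ X ∣) S≡T′ ⟨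
        parity ∣ e ∩ S ∣                               ≡⟨ trans pS₀ (sym pT₀) ⟩
        parity ∣ e ∩ T ∣                               ∎)

pivotCover : ∀ {n r} (L : List (Subset n)) → All (λ H → ∣ H ∣ ≡ r) L → PivotCover r L
pivotCover []      []            = PivotCover-[]
pivotCover (e ∷ L) (∣e∣≡r ∷ rs) with C ← pivotCover L rs | ⊆⊎∃∉ e (PivotCover.covered C)
... | inj₁ e⊆covered              = PivotCover-∷-⊆ C e e⊆covered
... | inj₂ (v , v∈e , v∉covered) = PivotCover-∷-∉ C e ∣e∣≡r v∈e v∉covered

Triangular : ∀ {n} → List (Subset n × Fin n) → Set
Triangular []             = Unit
Triangular ((H , v) ∷ Ps) = v ∈ H × All (v ∉_) (map proj₁ Ps) × Triangular Ps

pivotSet : ∀ {n} → List (Subset n × Fin n) → Subset n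
pivotSet []             = ⊥
pivotSet ((_ , v) ∷ Ps) = pivotSet Ps [ v ]≔ inside

∣pivotSet∣≤length : ∀ {n} (Ps : List (Subset n × Fin n)) → ∣ pivotSet Ps ∣ ≤ length Ps
∣pivotSet∣≤length {n} []             = ≤-reflexive (∣⊥∣≡0 n)
∣pivotSet∣≤length     ((_ , v) ∷ Ps) =
  ≤-trans (∣p[x]≔inside∣≤1+∣p∣ (pivotSet Ps) v) (s≤s (∣pivotSet∣≤length Ps))

parityTransversal-reachable : ∀ {n} c (Ps : List (Subset n × Fin n)) → Triangular Ps →
  ReachableWithin (pivotSet Ps) (ParityTransversal c (map proj₁ Ps))
parityTransversal-reachable c []             _                   S = S , [] , AgreeOutside-refl ⊥ S
parityTransversal-reachable c ((H , v) ∷ Ps) (v∈H , v∉Ps , tri) S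
  with T , pT , agree ← parityTransversal-reachable c Ps tri S =
  T [ v ]≔ b , pH ∷ ParityTransversal-[]≔ b v∉Ps pT , AgreeOutside-[]≔ (pivotSet Ps) S T v b agree
  where
  open ≡-Reasoning
  b : Bool
  b = lookup T v xor parity ∣ H ∩ T ∣ xor c
  pH : parity ∣ H ∩ (T [ v ]≔ b) ∣ ≡ c
  pH = begin
    parity ∣ H ∩ (T [ v ]≔ b) ∣                 ≡⟨ parity∣∩[]≔∣ T b v∈H ⟩
    parity ∣ H ∩ T ∣ xor lookup T v xor b       ≡⟨ cong (parity ∣ H ∩ T ∣ xor_) (x⊕x⊕y≡y (lookup T v) _) ⟩
    parity ∣ H ∩ T ∣ xor parity ∣ H ∩ T ∣ xor c ≡⟨ x⊕x⊕y≡y (parity ∣ H ∩ T ∣) c ⟩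
    c                                           ∎

record TriangularCover (r n : ℕ) : Set where
  field
    family     : List (Subset n × Fin n)
    triangular : Triangular family
    r-uniform  : All (λ H → ∣ H ∣ ≡ r) (map proj₁ family)
    covering   : ∀ x → Any (x ∈_) (map proj₁ family)

  hypergraph : Hypergraph r n
  hypergraph = record { edges = map proj₁ family ; uniform = r-uniform }

  noIsolated : NoIsolated hypergraph
  noIsolated x isolated = isolated (covering x)

-- the vertices x with a ≤ x < b
interval : ∀ {n} → ℕ → ℕ → Subset n
interval {zero}  _       _       = []
interval {suc n} zero    zero    = ⊥
interval {suc n} zero    (suc b) = inside ∷ interval zero b
interval {suc n} (suc a) zero    = ⊥
interval {suc n} (suc a) (suc b) = outside ∷ interval a b

∣interval∣ : ∀ {n} a b → b ≤ n → ∣ interval {n} a b ∣ ≡ b ∸ a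
∣interval∣ {zero}  a       zero    z≤n       = sym (0∸n≡0 a)
∣interval∣ {suc n} zero    zero    _         = ∣⊥∣≡0 (suc n)
∣interval∣ {suc n} zero    (suc b) (s≤s b≤n) = cong suc (∣interval∣ zero b b≤n)
∣interval∣ {suc n} (suc a) zero    _         = ∣⊥∣≡0 (suc n)
∣interval∣ {suc n} (suc a) (suc b) (s≤s b≤n) = ∣interval∣ a b b≤n

∈interval : ∀ {n} {a b} (x : Fin n) → a ≤ toℕ x → toℕ x < b → x ∈ interval a b
∈interval {a = zero}  {suc b} zero    _         _         = here
∈interval {a = zero}  {suc b} (suc x) _         (s≤s x<b) = there (∈interval x z≤n x<b)
∈interval {a = suc a} {suc b} (suc x) (s≤s a≤x) (s≤s x<b) = there (∈interval x a≤x x<b)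

∉interval : ∀ {n} {a b} (x : Fin n) → b ≤ toℕ x → x ∉ interval a b
∉interval {suc n} {zero}  {zero}  x       _         = ∉⊥
∉interval {suc n} {zero}  {suc b} (suc x) (s≤s b≤x) (there x∈) = ∉interval x b≤x x∈
∉interval {suc n} {suc a} {zero}  x       _         = ∉⊥
∉interval {suc n} {suc a} {suc b} (suc x) (s≤s b≤x) (there x∈) = ∉interval x b≤x x∈

module Blocks (r′ n : ℕ) where

  r : ℕ
  r = suc r′

  block : ℕ → Subset n
  block j = interval (j * r) (suc j * r)

  blocks : ∀ j → j * r ≤ n → List (Subset n × Fin n)
  blocks zero    _    = []
  blocks (suc j) jr≤n = (block j , fromℕ< jr≤n) ∷ blocks j (≤-trans (m≤n+m (j * r) r) jr≤n)

  blocks-length : ∀ j jr≤n → length (blocks j jr≤n) ≡ j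
  blocks-length zero    _    = refl
  blocks-length (suc j) jr≤n = cong suc (blocks-length j _)

  blocks-uniform : ∀ j jr≤n → All (λ H → ∣ H ∣ ≡ r) (map proj₁ (blocks j jr≤n))
  blocks-uniform zero    _    = []
  blocks-uniform (suc j) jr≤n =
    trans (∣interval∣ (j * r) (suc j * r) jr≤n) (m+n∸n≡m r (j * r)) ∷ blocks-uniform j _

  blocks-avoid : ∀ j jr≤n (x : Fin n) → j * r ≤ toℕ x → All (x ∉_) (map proj₁ (blocks j jr≤n))
  blocks-avoid zero    _    x _    = []
  blocks-avoid (suc j) jr≤n x jr≤x = ∉interval x jr≤x ∷ blocks-avoid j _ x (≤-trans (m≤n+m (j * r) r) jr≤x)

  blocks-triangular : ∀ j jr≤n → Triangular (blocks j jr≤n)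
  blocks-triangular zero    _    = tt
  blocks-triangular (suc j) jr≤n =
    ∈interval p jr≤p (subst (_< suc j * r) (sym p≡) ≤-refl) , blocks-avoid j _ p jr≤p , blocks-triangular j _
    where
    p  = fromℕ< jr≤n
    p≡ = toℕ-fromℕ< jr≤n
    jr≤p : j * r ≤ toℕ p
    jr≤p = subst (j * r ≤_) (sym p≡) (m≤n+m (j * r) r′)

  blocks-cover : ∀ j jr≤n (x : Fin n) → toℕ x < j * r → Any (x ∈_) (map proj₁ (blocks j jr≤n))
  blocks-cover (suc j) jr≤n x x<jr with toℕ x <? j * r
  ... | yes x<j′r = there (blocks-cover j _ x x<j′r)
  ... | no  x≮j′r = here (∈interval x (≮⇒≥ x≮j′r) x<jr)

⌊r′n/r⌋+1+q≤n : ∀ r′ {m} q s → m ≡ s + q * suc r′ → (r′ * suc m) / suc r′ + suc q ≤ suc m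
⌊r′n/r⌋+1+q≤n r′ q s refl = begin
  (r′ * n) / suc r′ + suc q    ≤⟨ +-monoˡ-≤ (suc q) (s≤s⁻¹ (m<n*o⇒m/o<n r′n<[1+s+qr′]r)) ⟩
  s + q * r′ + suc q           ≡⟨ regroup r′ q s ⟩
  n                            ∎
  where
  open ≤-Reasoning
  n = suc (s + q * suc r′)
  regroup : ∀ r′ q s → s + q * r′ + suc q ≡ suc (s + q * suc r′)
  regroup = solve-∀
  expand : ∀ r′ q s → suc (s + q * r′) * suc r′ ≡ r′ * suc (s + q * suc r′) + suc s
  expand = solve-∀
  r′n<[1+s+qr′]r : r′ * n < suc (s + q * r′) * suc r′
  r′n<[1+s+qr′]r = subst (r′ * n <_) (sym (expand r′ q s)) (m<m+n (r′ * n) z<s)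

-- The blocks [j r, (j + 1) r) for j < q = ⌊(n − 1)/r⌋ and the block [n − r, n), each with its last
-- vertex as pivot.
triangularCover : ∀ r′ n → suc r′ ≤ n →
  Σ (TriangularCover (suc r′) n) λ C → (r′ * n) / suc r′ + length (TriangularCover.family C) ≤ n
triangularCover r′ (suc m) r≤n = cover , bound
  where
  open Blocks r′ (suc m)
  q = m / r
  m≡s+qr : m ≡ m % r + q * r
  m≡s+qr = m≡m%n+[m/n]*n m r
  qr≤m : q * r ≤ m
  qr≤m = m/n*n≤m m r
  regular = blocks q (m≤n⇒m≤1+n qr≤m)
  lastBlock = interval (suc m ∸ r) (suc m)
  lastPivot = fromℕ m
  n∸r≤qr : suc m ∸ r ≤ q * r
  n∸r≤qr = m≤n+o⇒m∸n≤o (suc m) r (subst (λ k → suc k ≤ r + q * r) (sym m≡s+qr) (+-monoˡ-≤ (q * r) (m%n<n m r)))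
  lastPivot∈lastBlock : lastPivot ∈ lastBlock
  lastPivot∈lastBlock = ∈interval lastPivot (subst (suc m ∸ r ≤_) (sym (toℕ-fromℕ m)) (m∸n≤m m r′))
                                            (subst (_< suc m) (sym (toℕ-fromℕ m)) ≤-refl)
  covering : ∀ x → Any (x ∈_) (lastBlock ∷ map proj₁ regular)
  covering x with toℕ x <? q * r
  ... | yes x<qr = there (blocks-cover q _ x x<qr)
  ... | no  x≮qr = here (∈interval x (≤-trans n∸r≤qr (≮⇒≥ x≮qr)) (toℕ<n x))
  cover : TriangularCover r (suc m)
  cover = record
    { family     = (lastBlock , lastPivot) ∷ regular
    ; triangular = lastPivot∈lastBlock
                 , blocks-avoid q _ lastPivot (subst (q * r ≤_) (sym (toℕ-fromℕ m)) qr≤m)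
                 , blocks-triangular q _
    ; r-uniform  = trans (∣interval∣ (suc m ∸ r) (suc m) ≤-refl) (m∸[m∸n]≡n r≤n) ∷ blocks-uniform q _
    ; covering   = covering
    }
  bound : (r′ * suc m) / r + suc (length regular) ≤ suc m
  bound = subst (λ k → (r′ * suc m) / r + suc k ≤ suc m) (sym (blocks-length q _))
                (⌊r′n/r⌋+1+q≤n r′ q (m % r) m≡s+qr)

c*2^d≤2^n⇒c≤2^[n∸d] : ∀ c d n → c * 2 ^ d ≤ 2 ^ n → c ≤ 2 ^ (n ∸ d)
c*2^d≤2^n⇒c≤2^[n∸d] c d n c2^d≤2^n = *-cancelʳ-≤ c (2 ^ (n ∸ d)) (2 ^ d) {{m^n≢0 2 d}} (begin
  c * 2 ^ d           ≤⟨ c2^d≤2^n ⟩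
  2 ^ n               ≤⟨ ^-monoʳ-≤ 2 (m≤n+m∸n n d) ⟩
  2 ^ (d + (n ∸ d))   ≡⟨ ^-distribˡ-+-* 2 d (n ∸ d) ⟩
  2 ^ d * 2 ^ (n ∸ d) ≡⟨ *-comm (2 ^ d) (2 ^ (n ∸ d)) ⟩
  2 ^ (n ∸ d) * 2 ^ d ∎)
  where open ≤-Reasoning

2^n≤c*2^k⇒2^a≤c : ∀ c k n {a} → a + k ≤ n → 2 ^ n ≤ c * 2 ^ k → 2 ^ a ≤ c
2^n≤c*2^k⇒2^a≤c c k n {a} a+k≤n 2^n≤c2^k = *-cancelʳ-≤ (2 ^ a) c (2 ^ k) {{m^n≢0 2 k}} (begin
  2 ^ a * 2 ^ k ≡⟨ ^-distribˡ-+-* 2 a k ⟨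
  2 ^ (a + k)   ≤⟨ ^-monoʳ-≤ 2 a+k≤n ⟩
  2 ^ n         ≤⟨ 2^n≤c2^k ⟩
  c * 2 ^ k     ∎)
  where open ≤-Reasoning

n∸d≤⌊r′n/r⌋ : ∀ r′ n d → n ≤ suc r′ * d → n ∸ d ≤ (r′ * n) / suc r′
n∸d≤⌊r′n/r⌋ r′ n d n≤rd =
  subst (_≤ (r′ * n) / suc r′) (m*n/n≡m (n ∸ d) (suc r′)) (/-monoˡ-≤ (suc r′) (begin
  (n ∸ d) * suc r′         ≡⟨ *-distribʳ-∸ (suc r′) n d ⟩
  n * suc r′ ∸ d * suc r′  ≤⟨ ∸-monoʳ-≤ (n * suc r′) (subst (n ≤_) (*-comm (suc r′) d) n≤rd) ⟩
  n * suc r′ ∸ n           ≡⟨ cong (_∸ n) (*-suc n r′) ⟩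
  n + n * r′ ∸ n           ≡⟨ m+n∸m≡n n (n * r′) ⟩
  n * r′                   ≡⟨ *-comm n r′ ⟩
  r′ * n                   ∎))
  where open ≤-Reasoning

module _ {A : Pred ℕ 0ℓ} (A? : Decidable A) {c : Bool} where

  numTransversals*2^d≤2^n : ∀ {r n} (𝓗 : Hypergraph r n) → NoIsolated 𝓗 → (∀ {k} → A k → parity k ≡ c) →
    ∃ λ d → n ≤ r * d × numTransversals A A? 𝓗 * 2 ^ d ≤ 2 ^ n
  numTransversals*2^d≤2^n {r} {n} 𝓗 noIsolated A⇒c =
    ∣ pivots ∣ , n≤r*∣pivots∣ , count*2^∣D∣≤2^n pivots _ determinedTransversals
    where
    open PivotCover (pivotCover (edges 𝓗) (uniform 𝓗))
    everyVertexCovered : ⊤ ⊆ covered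
    everyVertexCovered {x} _ = decidable-stable (x ∈? covered) λ x∉covered →
      noIsolated x λ x∈edge →
        x∉covered (All.lookupWith (λ H⊆covered x∈H → H⊆covered x∈H) edges⊆covered x∈edge)
    n≤r*∣pivots∣ : n ≤ r * ∣ pivots ∣
    n≤r*∣pivots∣ = begin
      n             ≡⟨ ∣⊤∣≡n n ⟨
      ∣ ⊤ {n} ∣     ≤⟨ p⊆q⇒∣p∣≤∣q∣ everyVertexCovered ⟩
      ∣ covered ∣   ≤⟨ ∣covered∣≤r*∣pivots∣ ⟩
      r * ∣ pivots ∣ ∎
      where open ≤-Reasoning
    determinedTransversals : DeterminedOutside pivots (IsTransversal A 𝓗)
    determinedTransversals tS tT = determined c (All.map A⇒c tS) (All.map A⇒c tT)

  2^n≤numTransversals*2^length : ∀ {r n} (C : TriangularCover r n) → (∀ {k} → parity k ≡ c → A k) →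
    2 ^ n ≤ numTransversals A A? (TriangularCover.hypergraph C) * 2 ^ length (TriangularCover.family C)
  2^n≤numTransversals*2^length {n = n} C c⇒A = begin
    2 ^ n                              ≤⟨ 2^n≤count*2^∣D∣ (pivotSet family) P? reachable ⟩
    count P? * 2 ^ ∣ pivotSet family ∣ ≤⟨ *-monoʳ-≤ (count P?) (^-monoʳ-≤ 2 (∣pivotSet∣≤length family)) ⟩
    count P? * 2 ^ length family       ∎
    where
    open ≤-Reasoning
    open TriangularCover C
    P? = λ S → all? (λ H → A? ∣ H ∩ S ∣) (map proj₁ family)
    reachable : ReachableWithin (pivotSet family) (IsTransversal A hypergraph)
    reachable S with T , pT , agree ← parityTransversal-reachable c family triangular S =
      T , All.map c⇒A pT , agree

  IsG-parityClass : ∀ r′ n → suc r′ ≤ n →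
    (∀ {k} → A k → parity k ≡ c) → (∀ {k} → parity k ≡ c → A k) →
    IsG A A? (suc r′) n (2 ^ ((r′ * n) / suc r′))
  IsG-parityClass r′ n r≤n A⇒c c⇒A =
    upper , hypergraph , noIsolated , ≤-antisym (upper hypergraph noIsolated) lower
    where
    cover = proj₁ (triangularCover r′ n r≤n)
    open TriangularCover cover
    upper : (𝓗 : Hypergraph (suc r′) n) → NoIsolated 𝓗 → numTransversals A A? 𝓗 ≤ 2 ^ ((r′ * n) / suc r′)
    upper 𝓗 noIsolated𝓗 with d , n≤rd , count2^d≤2^n ← numTransversals*2^d≤2^n 𝓗 noIsolated𝓗 A⇒c =
      ≤-trans (c*2^d≤2^n⇒c≤2^[n∸d] _ d n count2^d≤2^n) (^-monoʳ-≤ 2 (n∸d≤⌊r′n/r⌋ r′ n d n≤rd))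
    lower : 2 ^ ((r′ * n) / suc r′) ≤ numTransversals A A? hypergraph
    lower = 2^n≤c*2^k⇒2^a≤c _ (length family) n (proj₂ (triangularCover r′ n r≤n))
              (2^n≤numTransversals*2^length cover c⇒A)

theorem4 : (r : ℕ) .{{_ : NonZero r}} → (n : ℕ) → r ≤ n →
    IsG Even Even? r n (2 ^ (((r ∸ 1) * n) / r))
      × IsG Odd Odd? r n (2 ^ (((r ∸ 1) * n) / r))
theorem4 (suc r′) n r≤n =
  IsG-parityClass Even? r′ n r≤n 2∣⇒parity≡false parity≡false⇒2∣ ,
  IsG-parityClass Odd?  r′ n r≤n 2∤⇒parity≡true parity≡true⇒2∤
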